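{- Suppose that $\{a_n\}_{n\ge0}$ is an even sequence with $a_0\neq0$, and let $A_n=\frac{1}{(n+1)(n+2)}\sum_{k=0}^na_k$ for $n\ge0$. Then $\{A_n\}_{n\ge0}$ is an even sequence.
   Context: A sequence $\{a_n\}_{n\ge0}$ of real (or complex) numbers is called an even sequence if $\sum_{k=0}^n\binom nk(-1)^ka_k=a_n$ for all $n=0,1,2,\ldots$. -}

module Defs where

open import Level using (Level)
open import Data.Nat using (ℕ; zero; suc)
open import Data.Nat.Combinatorics using (_C_)
open import Algebra.Bundles using (CommutativeRing)

module _ {c ℓ : Level} (R : CommutativeRing c ℓ) where
  open CommutativeRing R hiding (zero)

  ι : ℕ → Carrier
  ι zero    = 0#
  ι (suc n) = 1# + ι n

  sgn : ℕ → Carrier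
  sgn zero    = 1#
  sgn (suc k) = - sgn k

  sumTo : (ℕ → Carrier) → ℕ → Carrier
  sumTo f zero    = f zero
  sumTo f (suc n) = sumTo f n + f (suc n)

  IsEvenSeq : (ℕ → Carrier) → Set ℓ
  IsEvenSeq a = ∀ n → sumTo (λ k → ι (n C k) * sgn k * a k) n ≈ a n

  -- "positive integers are invertible": inv m is an inverse of m+1
  IsNatInverse : (ℕ → Carrier) → Set ℓ
  IsNatInverse inv = ∀ m → ι (suc m) * inv m ≈ 1#

  avgSeq : (ℕ → Carrier) → (ℕ → Carrier) → ℕ → Carrier
  avgSeq inv a n = (inv n * inv (suc n)) * sumTo a n

module Submission where

-- Write S k = a 0 + … + a k and w m = 1/((m+1)(m+2)), so that A k = w k · S k.
-- For d ∈ ℕ consider the shifted binomial transform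
--     𝔹 d g m = Σ_{k ≤ m} C(d+m, d+k) (-1)^k g k ,
-- whose case d = 0 is the transform occurring in the definition of evenness.
-- Three facts about it, valid for every d, make up the proof:
--   * Pascal's rule splits 𝔹 (d+1) into 𝔹 d plus a remainder whose upper
--     index is one lower; iterating it gives the hockey-stick identity
--         𝔹 (d+1) g n = Σ_{m ≤ n} 𝔹 d g m ;
--   * summation by parts:  𝔹 (d+1) (partial sums of f) m = 𝔹 d f m ;
--   * the absorption identity (k+1)(k+2) C(n+2,k+2) = (n+1)(n+2) C(n,k)
--     turns C(n,k) w k into w n C(n+2,k+2).
-- Hence Σ_k C(n,k)(-1)^k A k = w n · 𝔹 2 S n = w n · Σ_{m ≤ n} 𝔹 1 S m
-- = w n · Σ_{m ≤ n} 𝔹 0 a m = w n · Σ_{m ≤ n} a m = A n.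

open import Defs
open import Level using (Level)
open import Data.Nat using (ℕ)
open import Relation.Nullary using (¬_)
open import Algebra.Bundles using (CommutativeRing)

module BinomialIdentities where
  open import Data.Nat using (suc; zero; _+_; _*_; s≤s; z≤n)
  open import Data.Nat.Properties using (*-zeroʳ; *-comm; *-assoc; *-commutativeSemigroup)
  open import Data.Nat.Combinatorics using (_C_; nC1≡n; nCk+nC[k+1]≡[n+1]C[k+1])
  open import Data.Nat.Combinatorics.Specification using (k>n⇒nCk≡0)
  open import Data.Nat.Tactic.RingSolver using (solve-∀)
  open import Algebra.Properties.CommutativeSemigroup *-commutativeSemigroup using (x∙yz≈y∙xz)
  open import Relation.Binary.PropositionalEquality using (_≡_; refl; cong; cong₂; module ≡-Reasoning)
  open ≡-Reasoning

  absorption : ∀ n k → suc k * (suc n C suc k) ≡ suc n * (n C k)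
  absorption zero    zero    = refl
  absorption zero    (suc j) = begin
    suc (suc j) * (1 C suc (suc j))  ≡⟨ cong (suc (suc j) *_) (k>n⇒nCk≡0 {1} {suc (suc j)} (s≤s (s≤s z≤n))) ⟩
    suc (suc j) * 0                  ≡⟨ *-zeroʳ (suc (suc j)) ⟩
    0                                ≡⟨ cong (1 *_) (k>n⇒nCk≡0 {0} {suc j} (s≤s z≤n)) ⟨
    1 * (0 C suc j)                  ∎
  absorption (suc m) zero    = begin
    1 * (suc (suc m) C 1)            ≡⟨ cong (1 *_) (nC1≡n (suc (suc m))) ⟩
    1 * suc (suc m)                  ≡⟨ *-comm 1 (suc (suc m)) ⟩
    suc (suc m) * 1                  ∎
  absorption (suc m) (suc j) = begin
    suc (suc j) * (suc (suc m) C suc (suc j))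
      ≡⟨ cong (suc (suc j) *_) (nCk+nC[k+1]≡[n+1]C[k+1] (suc m) (suc j)) ⟨
    suc (suc j) * (P + Q)
      ≡⟨ regroup₁ j P Q ⟩
    suc j * P + suc (suc j) * Q + P
      ≡⟨ cong₂ (λ u v → u + v + P) (absorption m j) (absorption m (suc j)) ⟩
    suc m * (m C j) + suc m * (m C suc j) + P
      ≡⟨ regroup₂ m P (m C j) (m C suc j) ⟩
    suc m * (m C j + m C suc j) + P
      ≡⟨ cong (λ u → suc m * u + P) (nCk+nC[k+1]≡[n+1]C[k+1] m j) ⟩
    suc m * P + P
      ≡⟨ regroup₃ m P ⟩
    suc (suc m) * P
      ∎
    where
    P Q : ℕ
    P = suc m C suc j
    Q = suc m C suc (suc j)
    regroup₁ : ∀ j P Q → suc (suc j) * (P + Q) ≡ suc j * P + suc (suc j) * Q + P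
    regroup₁ = solve-∀
    regroup₂ : ∀ m P X Y → suc m * X + suc m * Y + P ≡ suc m * (X + Y) + P
    regroup₂ = solve-∀
    regroup₃ : ∀ m P → suc m * P + P ≡ suc (suc m) * P
    regroup₃ = solve-∀

  doubleAbsorption : ∀ n k → (suc k * suc (suc k)) * (suc (suc n) C suc (suc k))
                              ≡ (suc n * suc (suc n)) * (n C k)
  doubleAbsorption n k = begin
    (suc k * suc (suc k)) * (suc (suc n) C suc (suc k))
      ≡⟨ *-assoc (suc k) (suc (suc k)) (suc (suc n) C suc (suc k)) ⟩
    suc k * (suc (suc k) * (suc (suc n) C suc (suc k)))
      ≡⟨ cong (suc k *_) (absorption (suc n) (suc k)) ⟩
    suc k * (suc (suc n) * (suc n C suc k))
      ≡⟨ x∙yz≈y∙xz (suc k) (suc (suc n)) (suc n C suc k) ⟩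
    suc (suc n) * (suc k * (suc n C suc k))
      ≡⟨ cong (suc (suc n) *_) (absorption n k) ⟩
    suc (suc n) * (suc n * (n C k))
      ≡⟨ x∙yz≈y∙xz (suc (suc n)) (suc n) (n C k) ⟩
    suc n * (suc (suc n) * (n C k))
      ≡⟨ *-assoc (suc n) (suc (suc n)) (n C k) ⟨
    (suc n * suc (suc n)) * (n C k)
      ∎

module RingFacts {r ℓ : Level} (R : CommutativeRing r ℓ) where
  open CommutativeRing R hiding (zero)
  import Data.Nat as Nat
  open Nat using (suc; zero; _<_)
  open import Data.Nat.Properties using (n<1+n; +-suc)
  open import Data.Nat.Combinatorics using (_C_; nCk+nC[k+1]≡[n+1]C[k+1])
  open import Data.Nat.Combinatorics.Specification using (k>n⇒nCk≡0)
  open import Relation.Binary.PropositionalEquality as ≡ using (_≡_)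
  open import Relation.Binary.Reasoning.Setoid setoid
  open import Algebra.Properties.Ring ring using (-‿distribˡ-*; -‿distribʳ-*; -‿+-comm)
  open import Algebra.Properties.Group +-group using (//-rightDividesˡ)
  open import Algebra.Properties.Semiring.Mult semiring using (_×_; ×-homo-+; ×1-homo-*)
  open import Algebra.Properties.CommutativeSemigroup +-commutativeSemigroup
    using () renaming (interchange to +-interchange)
  open import Algebra.Properties.CommutativeSemigroup *-commutativeSemigroup
    using () renaming (interchange to *-interchange)

  ι≈×1# : ∀ n → ι R n ≈ n × 1#
  ι≈×1# zero    = refl
  ι≈×1# (suc n) = +-congˡ (ι≈×1# n)

  ι-homo-+ : ∀ m n → ι R (m Nat.+ n) ≈ ι R m + ι R n
  ι-homo-+ m n = begin
    ι R (m Nat.+ n)          ≈⟨ ι≈×1# (m Nat.+ n) ⟩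
    (m Nat.+ n) × 1#         ≈⟨ ×-homo-+ 1# m n ⟩
    m × 1# + n × 1#        ≈⟨ +-cong (ι≈×1# m) (ι≈×1# n) ⟨
    ι R m + ι R n          ∎

  ι-homo-* : ∀ m n → ι R (m Nat.* n) ≈ ι R m * ι R n
  ι-homo-* m n = begin
    ι R (m Nat.* n)          ≈⟨ ι≈×1# (m Nat.* n) ⟩
    (m Nat.* n) × 1#         ≈⟨ ×1-homo-* m n ⟩
    m × 1# * n × 1#        ≈⟨ *-cong (ι≈×1# m) (ι≈×1# n) ⟨
    ι R m * ι R n          ∎

  Σ-cong : ∀ {f g} → (∀ k → f k ≈ g k) → ∀ n → sumTo R f n ≈ sumTo R g n
  Σ-cong f≈g zero    = f≈g zero
  Σ-cong f≈g (suc n) = +-cong (Σ-cong f≈g n) (f≈g (suc n))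

  Σ-+ : ∀ f g n → sumTo R (λ k → f k + g k) n ≈ sumTo R f n + sumTo R g n
  Σ-+ f g zero    = refl
  Σ-+ f g (suc n) = trans (+-congʳ (Σ-+ f g n)) (+-interchange _ _ _ _)

  Σ-* : ∀ x f n → sumTo R (λ k → x * f k) n ≈ x * sumTo R f n
  Σ-* x f zero    = refl
  Σ-* x f (suc n) = trans (+-congʳ (Σ-* x f n)) (sym (distribˡ x _ _))

  Σ-neg : ∀ f n → sumTo R (λ k → - f k) n ≈ - sumTo R f n
  Σ-neg f zero    = refl
  Σ-neg f (suc n) = trans (+-congʳ (Σ-neg f n)) (-‿+-comm _ _)

  Σ-head : ∀ f n → sumTo R f (suc n) ≈ f 0 + sumTo R (λ k → f (suc k)) n
  Σ-head f zero    = refl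
  Σ-head f (suc n) = trans (+-congʳ (Σ-head f n)) (+-assoc _ _ _)

  Σ-dropLast : ∀ f n → f (suc n) ≈ 0# → sumTo R f (suc n) ≈ sumTo R f n
  Σ-dropLast f n fₙ₊₁≈0 = trans (+-congˡ fₙ₊₁≈0) (+-identityʳ _)

  bterm : ℕ → ℕ → ℕ → Carrier → Carrier
  bterm N j k x = ι R (N C j) * sgn R k * x

  bterm-reindex : ∀ {N N′ j j′} k x → N ≡ N′ → j ≡ j′ → bterm N j k x ≈ bterm N′ j′ k x
  bterm-reindex k x ≡.refl ≡.refl = refl

  bterm-vanish : ∀ {N j} k x → N < j → bterm N j k x ≈ 0#
  bterm-vanish {N} {j} k x N<j = begin
    ι R (N C j) * sgn R k * x  ≈⟨ *-congʳ (*-congʳ (reflexive (≡.cong (ι R) (k>n⇒nCk≡0 N<j)))) ⟩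
    0# * sgn R k * x           ≈⟨ *-congʳ (zeroˡ (sgn R k)) ⟩
    0# * x                     ≈⟨ zeroˡ x ⟩
    0#                         ∎

  bterm-pascal : ∀ N j k x → bterm (suc N) (suc j) k x ≈ bterm N j k x + bterm N (suc j) k x
  bterm-pascal N j k x = begin
    ι R (suc N C suc j) * s * x
      ≈⟨ *-congʳ (*-congʳ (reflexive (≡.cong (ι R) (nCk+nC[k+1]≡[n+1]C[k+1] N j)))) ⟨
    ι R (N C j Nat.+ N C suc j) * s * x
      ≈⟨ *-congʳ (*-congʳ (ι-homo-+ (N C j) (N C suc j))) ⟩
    (ι R (N C j) + ι R (N C suc j)) * s * x
      ≈⟨ *-congʳ (distribʳ s (ι R (N C j)) (ι R (N C suc j))) ⟩
    (ι R (N C j) * s + ι R (N C suc j) * s) * x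
      ≈⟨ distribʳ x (ι R (N C j) * s) (ι R (N C suc j) * s) ⟩
    ι R (N C j) * s * x + ι R (N C suc j) * s * x
      ∎
    where
    s : Carrier
    s = sgn R k

  -- Raising the sign index flips the sign: the summation-by-parts step.
  bterm-sign : ∀ N j k x y → bterm N j (suc k) (x + y) ≈ bterm N j (suc k) y + - bterm N j k x
  bterm-sign N j k x y = begin
    c * - s * (x + y)              ≈⟨ distribˡ (c * - s) x y ⟩
    c * - s * x + c * - s * y      ≈⟨ +-comm (c * - s * x) (c * - s * y) ⟩
    c * - s * y + c * - s * x      ≈⟨ +-congˡ (*-congʳ (-‿distribʳ-* c s)) ⟨
    c * - s * y + - (c * s) * x    ≈⟨ +-congˡ (-‿distribˡ-* (c * s) x) ⟨
    c * - s * y + - (c * s * x)    ∎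
    where
    c s : Carrier
    c = ι R (N C j)
    s = sgn R k

  𝔹 : ℕ → (ℕ → Carrier) → ℕ → Carrier
  𝔹 d g m = sumTo R (λ k → bterm (d Nat.+ m) (d Nat.+ k) k (g k)) m

  -- The part of 𝔹 (d+1) g m that Pascal's rule moves one step off the diagonal.
  remainder : ℕ → (ℕ → Carrier) → ℕ → Carrier
  remainder d g m = sumTo R (λ k → bterm (d Nat.+ m) (suc (d Nat.+ k)) k (g k)) m

  𝔹-pascal : ∀ d g m → 𝔹 (suc d) g m ≈ 𝔹 d g m + remainder d g m
  𝔹-pascal d g m = trans (Σ-cong (λ k → bterm-pascal (d Nat.+ m) (d Nat.+ k) k (g k)) m)
                         (Σ-+ _ _ m)

  remainder-zero : ∀ d g → remainder d g 0 ≈ 0#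
  remainder-zero d g = bterm-vanish 0 (g 0) (n<1+n (d Nat.+ 0))

  remainder-suc : ∀ d g n → remainder d g (suc n) ≈ 𝔹 (suc d) g n
  remainder-suc d g n = begin
    remainder d g (suc n)
      ≈⟨ Σ-dropLast _ n (bterm-vanish (suc n) (g (suc n)) (n<1+n (d Nat.+ suc n))) ⟩
    sumTo R (λ k → bterm (d Nat.+ suc n) (suc (d Nat.+ k)) k (g k)) n
      ≈⟨ Σ-cong (λ k → bterm-reindex {j = suc (d Nat.+ k)} k (g k) (+-suc d n) ≡.refl) n ⟩
    𝔹 (suc d) g n
      ∎

  hockeyStick : ∀ d g n → 𝔹 (suc d) g n ≈ sumTo R (𝔹 d g) n
  hockeyStick d g zero    = trans (𝔹-pascal d g 0) (trans (+-congˡ (remainder-zero d g)) (+-identityʳ _))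
  hockeyStick d g (suc n) = begin
    𝔹 (suc d) g (suc n)                      ≈⟨ 𝔹-pascal d g (suc n) ⟩
    𝔹 d g (suc n) + remainder d g (suc n)    ≈⟨ +-congˡ (remainder-suc d g n) ⟩
    𝔹 d g (suc n) + 𝔹 (suc d) g n            ≈⟨ +-congˡ (hockeyStick d g n) ⟩
    𝔹 d g (suc n) + sumTo R (𝔹 d g) n        ≈⟨ +-comm _ _ ⟩
    sumTo R (𝔹 d g) (suc n)                  ∎

  -- Summation by parts: writing S k = f 0 + … + f k, one has S (j+1) = S j + f (j+1), so
  --   𝔹 d S (p+1) = 𝔹 d f (p+1) − Σ_{k ≤ p} C(d+p+1, d+k+1) (-1)^k S k.
  𝔹-byParts : ∀ d f p →
    𝔹 d (sumTo R f) (suc p) ≈ 𝔹 d f (suc p) + - sumTo R (λ k → bterm (d Nat.+ suc p) (suc (d Nat.+ k)) k (sumTo R f k)) p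
  𝔹-byParts d f p = begin
    𝔹 d S (suc p)
      ≈⟨ Σ-head _ p ⟩
    first + sumTo R (λ j → bterm N (d Nat.+ suc j) (suc j) (S j + f (suc j))) p
      ≈⟨ +-congˡ (Σ-cong step p) ⟩
    first + sumTo R (λ j → bterm N (d Nat.+ suc j) (suc j) (f (suc j)) + - lower j) p
      ≈⟨ +-congˡ (trans (Σ-+ _ _ p) (+-congˡ (Σ-neg lower p))) ⟩
    first + (sumTo R (λ j → bterm N (d Nat.+ suc j) (suc j) (f (suc j))) p + - sumTo R lower p)
      ≈⟨ +-assoc first _ _ ⟨
    (first + sumTo R (λ j → bterm N (d Nat.+ suc j) (suc j) (f (suc j))) p) + - sumTo R lower p
      ≈⟨ +-congʳ (Σ-head _ p) ⟨
    𝔹 d f (suc p) + - sumTo R lower p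
      ∎
    where
    S : ℕ → Carrier
    S = sumTo R f
    N : ℕ
    N = d Nat.+ suc p
    first : Carrier
    first = bterm N (d Nat.+ 0) 0 (f 0)
    lower : ℕ → Carrier
    lower k = bterm N (suc (d Nat.+ k)) k (S k)
    step : ∀ j → bterm N (d Nat.+ suc j) (suc j) (S j + f (suc j))
                 ≈ bterm N (d Nat.+ suc j) (suc j) (f (suc j)) + - lower j
    step j = trans (bterm-sign N (d Nat.+ suc j) j (S j) (f (suc j)))
                   (+-congˡ (-‿cong (bterm-reindex j (S j) ≡.refl (+-suc d j))))

  𝔹-partialSums : ∀ d f m → 𝔹 (suc d) (sumTo R f) m ≈ 𝔹 d f m
  𝔹-partialSums d f m = trans (𝔹-pascal d S m) (telescope m)
    where
    S : ℕ → Carrier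
    S = sumTo R f
    telescope : ∀ m → 𝔹 d S m + remainder d S m ≈ 𝔹 d f m
    telescope zero    = trans (+-congˡ (remainder-zero d S)) (+-identityʳ _)
    telescope (suc p) = begin
      𝔹 d S (suc p) + remainder d S (suc p)
        ≈⟨ +-cong (𝔹-byParts d f p) (Σ-dropLast _ p (bterm-vanish (suc p) (S (suc p)) (n<1+n (d Nat.+ suc p)))) ⟩
      𝔹 d f (suc p) + - W + W
        ≈⟨ //-rightDividesˡ W (𝔹 d f (suc p)) ⟩  -- (y − W) + W = y
      𝔹 d f (suc p)
        ∎
      where
      W : Carrier
      W = sumTo R (λ k → bterm (d Nat.+ suc p) (suc (d Nat.+ k)) k (S k)) p

  *-inverse : ∀ {x x′ y y′} → x * x′ ≈ 1# → y * y′ ≈ 1# → (x * y) * (x′ * y′) ≈ 1#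
  *-inverse {x} {x′} {y} {y′} xx′≈1 yy′≈1 =
    trans (*-interchange x y x′ y′) (trans (*-cong xx′≈1 yy′≈1) (*-identityˡ 1#))

  cross-multiply : ∀ {p P q Q x y} → p * P ≈ 1# → Q * q ≈ 1# → P * x ≈ Q * y → x * q ≈ p * y
  cross-multiply {p} {P} {q} {Q} {x} {y} pP≈1 Qq≈1 Px≈Qy = begin
    x * q                ≈⟨ *-identityˡ (x * q) ⟨
    1# * (x * q)         ≈⟨ *-congʳ pP≈1 ⟨
    p * P * (x * q)      ≈⟨ *-assoc p P (x * q) ⟩
    p * (P * (x * q))    ≈⟨ *-congˡ (*-assoc P x q) ⟨
    p * (P * x * q)      ≈⟨ *-congˡ (*-congʳ (trans Px≈Qy (*-comm Q y))) ⟩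
    p * (y * Q * q)      ≈⟨ *-congˡ (*-assoc y Q q) ⟩
    p * (y * (Q * q))    ≈⟨ *-congˡ (*-congˡ Qq≈1) ⟩
    p * (y * 1#)         ≈⟨ *-congˡ (*-identityʳ y) ⟩
    p * y                ∎

  bterm-rescale : ∀ N j k {c r p x} → c * r ≈ p * ι R (N C j) →
                  c * sgn R k * (r * x) ≈ p * bterm N j k x
  bterm-rescale N j k {c} {r} {p} {x} cr≈pC = begin
    c * s * (r * x)      ≈⟨ *-interchange c s r x ⟩
    c * r * (s * x)      ≈⟨ *-congʳ cr≈pC ⟩
    p * C′ * (s * x)     ≈⟨ *-assoc p C′ (s * x) ⟩
    p * (C′ * (s * x))   ≈⟨ *-congˡ (*-assoc C′ s x) ⟨
    p * (C′ * s * x)     ∎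
    where
    s C′ : Carrier
    s = sgn R k
    C′ = ι R (N C j)

  module Weights (inv : ℕ → Carrier) (isInv : IsNatInverse R inv) where
    open BinomialIdentities using (doubleAbsorption)

    w : ℕ → Carrier
    w m = inv m * inv (suc m)

    w-inverse : ∀ m → ι R (suc m Nat.* suc (suc m)) * w m ≈ 1#
    w-inverse m = trans (*-congʳ (ι-homo-* (suc m) (suc (suc m)))) (*-inverse (isInv m) (isInv (suc m)))

    -- C(n,k) w k = w n C(n+2,k+2), from (k+1)(k+2) C(n+2,k+2) = (n+1)(n+2) C(n,k).
    weight-exchange : ∀ n k → ι R (n C k) * w k ≈ w n * ι R (suc (suc n) C suc (suc k))
    weight-exchange n k =
      cross-multiply (trans (*-comm (w n) _) (w-inverse n)) (w-inverse k) cleared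
      where
      cleared : ι R (suc n Nat.* suc (suc n)) * ι R (n C k)
                ≈ ι R (suc k Nat.* suc (suc k)) * ι R (suc (suc n) C suc (suc k))
      cleared = begin
        ι R (suc n Nat.* suc (suc n)) * ι R (n C k)
          ≈⟨ ι-homo-* (suc n Nat.* suc (suc n)) (n C k) ⟨
        ι R (suc n Nat.* suc (suc n) Nat.* (n C k))
          ≈⟨ reflexive (≡.cong (ι R) (doubleAbsorption n k)) ⟨
        ι R (suc k Nat.* suc (suc k) Nat.* (suc (suc n) C suc (suc k)))
          ≈⟨ ι-homo-* (suc k Nat.* suc (suc k)) (suc (suc n) C suc (suc k)) ⟩
        ι R (suc k Nat.* suc (suc k)) * ι R (suc (suc n) C suc (suc k))
          ∎

theorem2p9 : ∀ {c ℓ : Level} (R : CommutativeRing c ℓ)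
    → (inv : ℕ → CommutativeRing.Carrier R) → IsNatInverse R inv
    → (a : ℕ → CommutativeRing.Carrier R) → IsEvenSeq R a
    → ¬ (CommutativeRing._≈_ R (a 0) (CommutativeRing.0# R))
    → IsEvenSeq R (avgSeq R inv a)
theorem2p9 R inv isInv a even _ n = begin
    sumTo R (λ k → ι R (n C k) * sgn R k * (w k * S k)) n
  ≈⟨ Σ-cong (λ k → bterm-rescale (2 + n) (2 + k) k (weight-exchange n k)) n ⟩
    sumTo R (λ k → w n * bterm (2 + n) (2 + k) k (S k)) n
  ≈⟨ Σ-* (w n) _ n ⟩
    w n * 𝔹 2 S n
  ≈⟨ *-congˡ (hockeyStick 1 S n) ⟩
    w n * sumTo R (𝔹 1 S) n
  ≈⟨ *-congˡ (Σ-cong (𝔹-partialSums 0 a) n) ⟩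
    w n * sumTo R (𝔹 0 a) n
  ≈⟨ *-congˡ (Σ-cong even n) ⟩
    w n * S n
  ∎
  where
  open CommutativeRing R using (Carrier; setoid; _*_; *-congˡ)
  open import Data.Nat using (_+_)
  open import Data.Nat.Combinatorics using (_C_)
  open import Relation.Binary.Reasoning.Setoid setoid
  open RingFacts R
  open Weights inv isInv
  S : ℕ → Carrier
  S = sumTo R a
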